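{- Let $k\in\mathbb{N}_0$, let $T$ be a full binary tree with inner nodes labelled injectively by variables, and let $\emptyset\neq V_0,V_1\subseteq\mathrm{lvs}(T)$ be depth-$k$-incomparable for $T$. Let $F := D(F_1(T))$ and consider the trigger hypergraph $\mathcal{T}_k(F)$. Then the hyperedges $E^k_{C_{V_0}}$ and $E^k_{C_{V_1}}$ are disjoint.
   Context: Clauses are finite sets of literals without complementary pair, clause-sets finite sets of clauses; $\overline{C}$ is the set of complements of literals of $C$; $\mathrm{prc}_0(G)$ the set of prime implicates of $G$ (inclusion-minimal implied clauses). Tree clause-sets: the edge from an inner node labelled $v$ to its left child is labelled $v$, to its right child $\overline{v}$; for a leaf $w$, $C_w$ is the set of edge labels on the root-to-$w$ path; $F_1(T) := \{C_w : w\in\mathrm{lvs}(T)\}$ ($\mathrm{lvs}(T)$ the leaves). Doping: each clause $C$ of $F_1(T)$ gets a distinct new variable $u_C$, and $D(F_1(T)) := \{C\cup\{u_C\}\}$. For $\emptyset\ne V\subseteq\mathrm{lvs}(T)$, $C_V$ is the set of pure literals of $\{C_w\cup\{u_{C_w}\} : w\in V\}$ (literals occurring in it whose complement does not occur); $C_V$ is a prime implicate of $D(F_1(T))$. Depth-$k$-incomparability: every leaf of $T$ has depth at least $k+1$, and for every node $w$ of depth $k$ (distance from the root) the sets $V_0\cap\mathrm{lvs}(T_w)$ and $V_1\cap\mathrm{lvs}(T_w)$ are incomparable w.r.t. inclusion, where $T_w$ is the subtree rooted at $w$. Trigger hypergraph $\mathcal{T}_k(G)$: vertex set $\mathrm{prc}_0(G)$,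 hyperedges $E^k_C := \{C'\in\mathrm{prc}_0(G): C'\cap\overline{C}=\emptyset,\ |C'\setminus C|\le k\}$ for $C\in\mathrm{prc}_0(G)$. -}

module Defs where

open import Data.Nat using (ℕ; _≤_; suc)
open import Data.Nat.Properties using () renaming (_≟_ to _≟ℕ_)
open import Data.Bool using (Bool; true; false; not)
open import Data.Bool.Properties using () renaming (_≟_ to _≟B_)
open import Data.Product using (_×_; _,_; Σ; ∃; proj₁)
open import Data.Product.Properties using (≡-dec)
open import Data.List using (List; []; _∷_; _++_; map; concat; filter; length; deduplicate; [_])
open import Data.List.Membership.Propositional using (_∈_; _∉_)
open import Data.List.Relation.Unary.Unique.Propositional using (Unique)
open import Data.Maybe using (Maybe; just; nothing)
open import Relation.Binary.PropositionalEquality using (_≡_)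
open import Relation.Nullary using (¬_; ¬?)
open import Relation.Binary using (DecidableEquality)

Var : Set
Var = ℕ

-- (v , true) is the positive literal v, (v , false) is its complement.
Lit : Set
Lit = Var × Bool

_≟L_ : DecidableEquality Lit
_≟L_ = ≡-dec _≟ℕ_ _≟B_

open import Data.List.Membership.DecPropositional _≟L_ using (_∈?_)

compl : Lit → Lit
compl (v , b) = (v , not b)

-- Clauses are finite sets of literals, represented by lists (set semantics
-- via membership); clause-sets are lists of clauses.
Clause : Set
Clause = List Lit

ClauseSet : Set
ClauseSet = List Clause

_⊆C_ : Clause → Clause → Set
C ⊆C D = ∀ {x} → x ∈ C → x ∈ D

IsClause : Clause → Set
IsClause C = ∀ {x} → x ∈ C → compl x ∉ C

Assignment : Set
Assignment = Var → Bool

satL : Assignment → Lit → Set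
satL α (v , b) = α v ≡ b

satC : Assignment → Clause → Set
satC α C = Σ Lit λ x → x ∈ C × satL α x

satF : Assignment → ClauseSet → Set
satF α G = ∀ {D} → D ∈ G → satC α D

_⊨_ : ClauseSet → Clause → Set
G ⊨ C = ∀ (α : Assignment) → satF α G → satC α C

IsPrimeImplicate : ClauseSet → Clause → Set
IsPrimeImplicate G C =
  IsClause C × G ⊨ C ×
  (∀ (C'' : Clause) → IsClause C'' → C'' ⊆C C → G ⊨ C'' → C ⊆C C'')

_∖C_ : Clause → Clause → Clause
C' ∖C C = filter (λ x → ¬? (x ∈? C)) C'

card : Clause → ℕ
card C = length (deduplicate _≟L_ C)

-- Membership C' ∈ E^k_C in the trigger hypergraph T_k(G)
InHyperedge : ℕ → ClauseSet → Clause → Clause → Set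
InHyperedge k G C C' =
  IsPrimeImplicate G C' ×
  (∀ {x} → x ∈ C' → compl x ∉ C) ×
  card (C' ∖C C) ≤ k

data Tree : Set where
  leaf : Tree
  node : Var → Tree → Tree → Tree

Addr : Set
Addr = List Bool

labels : Tree → List Var
labels leaf = []
labels (node v l r) = v ∷ labels l ++ labels r

subtree : Tree → Addr → Maybe Tree
subtree t [] = just t
subtree leaf (_ ∷ _) = nothing
subtree (node v l r) (false ∷ p) = subtree l p
subtree (node v l r) (true ∷ p) = subtree r p

lvs : Tree → List Addr
lvs leaf = [ [] ]
lvs (node v l r) = map (false ∷_) (lvs l) ++ map (true ∷_) (lvs r)

-- C_w : edge labels on the root-to-w path
-- (edge to left child labelled v, edge to right child labelled v̄)
pathClause : Tree → Addr → Clause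
pathClause leaf _ = []
pathClause (node v l r) [] = []
pathClause (node v l r) (false ∷ p) = (v , true) ∷ pathClause l p
pathClause (node v l r) (true ∷ p) = (v , false) ∷ pathClause r p

-- Doping with new variables u : leaves → Var (u w = u_{C_w})
ValidDoping : Tree → (Addr → Var) → Set
ValidDoping T u =
  (∀ {w w'} → w ∈ lvs T → w' ∈ lvs T → u w ≡ u w' → w ≡ w') ×
  (∀ {w} → w ∈ lvs T → u w ∉ labels T)

dopedClause : Tree → (Addr → Var) → Addr → Clause
dopedClause T u w = pathClause T w ++ [ (u w , true) ]

DF1 : Tree → (Addr → Var) → ClauseSet
DF1 T u = map (dopedClause T u) (lvs T)

CV : Tree → (Addr → Var) → List Addr → Clause
CV T u V = filter (λ x → ¬? (compl x ∈? L)) L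
  where L = concat (map (dopedClause T u) V)

_⊆A_ : List Addr → List Addr → Set
A ⊆A B = ∀ {w} → w ∈ A → w ∈ B

NonEmpty : List Addr → Set
NonEmpty V = Σ Addr λ w → w ∈ V

data _≼_ : Addr → Addr → Set where
  []≼ : ∀ {w} → [] ≼ w
  ∷≼  : ∀ {b p w} → p ≼ w → (b ∷ p) ≼ (b ∷ w)

-- V ∩ lvs(T_p), membership form
InSubtree : List Addr → Addr → Addr → Set
InSubtree V p w = w ∈ V × p ≼ w

Incomparable : (Addr → Set) → (Addr → Set) → Set
Incomparable A B =
  ¬ (∀ w → A w → B w) × ¬ (∀ w → B w → A w)

DepthIncomparable : ℕ → Tree → List Addr → List Addr → Set
DepthIncomparable k T V₀ V₁ =
  (∀ {w} → w ∈ lvs T → suc k ≤ length w) ×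
  (∀ (p : Addr) (t : Tree) → subtree T p ≡ just t → length p ≡ k →
     Incomparable (InSubtree V₀ p) (InSubtree V₁ p))

-- Write Aₛ for C ∖ C_{Vₛ}. For a leaf w, an assignment falsifying C and C_w and setting u_w true
-- satisfies D(F₁(T)), since the path of every other leaf clashes with C_w; hence the implicate C
-- contains u_w or the complement of a literal of C_w. Now descend from the root. At a node v with a
-- literal of v in C, that literal lies in both A₀ and A₁ (each Vₛ has a leaf below the other child,
-- whose path contains its complement), and we continue into the child whose edge carries the literal;
-- at a node whose variable does not occur in C we continue into both children. At depth k the
-- incomparability gives leaves w₀ ∈ V₀ ∖ V₁ and w₁ ∈ V₁ ∖ V₀ below the node, and each contributes
-- a literal (u_{wₛ} or the complement of a path literal below the node) to A₀ or A₁. All literals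
-- found have distinct variables, so |A₀| + |A₁| ≥ 2(k + 1) and not both are at most k.

module Submission where

open import Defs
open import Data.Nat using (ℕ; zero; suc; _+_; _*_; _≤_; _<_; z≤n; s≤s; z<s)
open import Data.Nat.Properties
  using (≤-refl; ≤-trans; +-mono-≤; +-monoˡ-≤; m≤m+n; m<m+n; m<n+m; <⇒≱; <-asym; +-assoc; +-identityʳ; *-comm)
open import Data.Bool using (Bool; true; false; not; if_then_else_)
open import Data.Bool.Properties using (¬-not; not-¬; not-involutive) renaming (_≟_ to _≟B_)
open import Data.Product using (_×_; _,_; Σ; ∃; proj₁; proj₂)
open import Data.Product.Properties using (≡-dec)
open import Data.Sum using (_⊎_; inj₁; inj₂; [_,_]′)
open import Data.List using (List; []; _∷_; _++_; map; concat; filter; length; deduplicate; [_])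
import Data.List.Properties as List
open import Data.List.Membership.Propositional using (_∈_; _∉_; find; lose)
open import Data.List.Membership.Propositional.Properties
  using (∈-++⁺ˡ; ∈-++⁺ʳ; ∈-++⁻; ∈-map⁺; ∈-map⁻; ∈-filter⁺; ∈-filter⁻; ∈-concat⁺′; ∈-concat⁻′; ∈-deduplicate⁺)
import Data.List.Membership.DecPropositional as DecMembership
open import Data.List.Relation.Unary.Any using (here; there; any?)
import Data.List.Relation.Unary.Any as Any
open import Data.List.Relation.Unary.All using (All; []; _∷_; lookup)
import Data.List.Relation.Unary.All as All
import Data.List.Relation.Unary.All.Properties as All
open import Data.List.Relation.Unary.AllPairs using ([]; _∷_)
open import Data.List.Relation.Unary.Unique.Propositional using (Unique)
import Data.List.Relation.Unary.Unique.Propositional.Properties as Unique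
open import Data.List.Relation.Binary.Subset.Propositional using (_⊆_)
open import Data.List.Relation.Binary.Disjoint.Propositional using (Disjoint)
open import Data.Maybe using (just)
open import Data.Empty using (⊥; ⊥-elim)
open import Function using (_∘_)
open import Relation.Binary using (DecidableEquality)
open import Relation.Binary.PropositionalEquality
  using (_≡_; _≢_; refl; sym; trans; cong; cong₂; subst; module ≡-Reasoning)
open import Relation.Nullary using (¬_; Dec; yes; no; does; ¬?)
open import Relation.Nullary.Decidable using (_×-dec_)
open import Data.List.Membership.DecPropositional _≟L_ using (_∈?_)

module _ {a} {A : Set a} (_≟_ : DecidableEquality A) where

  Unique-⊆⇒length≤ : ∀ {xs ys : List A} → Unique xs → xs ⊆ ys → length xs ≤ length ys
  Unique-⊆⇒length≤ {[]} _ _ = z≤n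
  Unique-⊆⇒length≤ {x ∷ xs} {ys} (x∉xs ∷ xs!) xs⊆ys =
    ≤-trans (s≤s (Unique-⊆⇒length≤ xs! xs⊆ys∖x))
            (List.filter-notAll P? ys (Any.map (λ x≡y y≢x → y≢x (sym x≡y)) (xs⊆ys (here refl))))
    where
    P? : ∀ y → Dec (¬ y ≡ x)
    P? y = ¬? (y ≟ x)
    xs⊆ys∖x : xs ⊆ filter P? ys
    xs⊆ys∖x y∈xs = ∈-filter⁺ P? (xs⊆ys (there y∈xs)) (λ y≡x → lookup x∉xs y∈xs (sym y≡x))

Unique-++⁻ : ∀ {a} {A : Set a} (xs : List A) {ys} → Unique (xs ++ ys) →
             Unique xs × Unique ys × Disjoint xs ys
Unique-++⁻ [] ys! = [] , ys! , λ ()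
Unique-++⁻ (x ∷ xs) (x∉ ∷ xs++ys!) with Unique-++⁻ xs xs++ys!
... | xs! , ys! , xs#ys = All.++⁻ˡ xs x∉ ∷ xs! , ys! , λ
  { (here refl , y∈ys) → lookup (All.++⁻ʳ xs x∉) y∈ys refl
  ; (there y∈xs , y∈ys) → xs#ys (y∈xs , y∈ys) }

*2-step : ∀ n {a b} → suc n * 2 ≤ a → suc n * 2 ≤ b → suc (suc n) * 2 ≤ a + b
*2-step n a≥ b≥ = ≤-trans (+-monoˡ-≤ (suc n * 2) (m≤m+n 2 (n * 2))) (+-mono-≤ a≥ b≥)

suc*2≰+ : ∀ k → ¬ (suc k * 2 ≤ k + k)
suc*2≰+ k = <⇒≱ (subst (_< suc k * 2) k*2≡k+k (m<n+m (k * 2) z<s))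
  where
  k*2≡k+k : k * 2 ≡ k + k
  k*2≡k+k = trans (*-comm k 2) (cong (k +_) (+-identityʳ k))

compl-involutive : ∀ ℓ → compl (compl ℓ) ≡ ℓ
compl-involutive (v , b) = cong (v ,_) (not-involutive b)

compl-≢ : ∀ ℓ → compl ℓ ≢ ℓ
compl-≢ (v , b) eq = not-¬ refl (sym (cong proj₂ eq))

satL-compl : ∀ α ℓ → ¬ satL α (compl ℓ) → satL α ℓ
satL-compl α (v , b) ¬sat = trans (¬-not ¬sat) (not-involutive b)

IsClause-++⁺ : ∀ {C D} → IsClause C → IsClause D → (∀ {x} → x ∈ C → compl x ∉ D) → IsClause (C ++ D)
IsClause-++⁺ {C} {D} C-clause D-clause cross x∈ x̄∈ with ∈-++⁻ C x∈ | ∈-++⁻ C x̄∈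
... | inj₁ x∈C | inj₁ x̄∈C = C-clause x∈C x̄∈C
... | inj₁ x∈C | inj₂ x̄∈D = cross x∈C x̄∈D
... | inj₂ x∈D | inj₁ x̄∈C = cross x̄∈C (subst (_∈ D) (sym (compl-involutive _)) x∈D)
... | inj₂ x∈D | inj₂ x̄∈D = D-clause x∈D x̄∈D

falsify : Clause → Assignment
falsify D v = not (does ((v , true) ∈? D))

falsify-falsifies : ∀ {D} → IsClause D → ∀ {ℓ} → ℓ ∈ D → ¬ satL (falsify D) ℓ
falsify-falsifies {D} D-clause {v , b} ℓ∈ sat with (v , true) ∈? D
falsify-falsifies D-clause {v , true}  ℓ∈ ()   | yes _
falsify-falsifies D-clause {v , false} ℓ∈ refl | yes v∈ = D-clause ℓ∈ v∈
falsify-falsifies D-clause {v , true}  ℓ∈ refl | no v∉ = v∉ ℓ∈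
falsify-falsifies D-clause {v , false} ℓ∈ ()   | no _

≼-trans : ∀ {p q w} → p ≼ q → q ≼ w → p ≼ w
≼-trans []≼ _ = []≼
≼-trans (∷≼ p≼q) (∷≼ q≼w) = ∷≼ (≼-trans p≼q q≼w)

≼-++ : ∀ p q → p ≼ (p ++ q)
≼-++ [] q = []≼
≼-++ (b ∷ p) q = ∷≼ (≼-++ p q)

≼⇒++ : ∀ {p w} → p ≼ w → ∃ λ q → w ≡ p ++ q
≼⇒++ {w = w} []≼ = w , refl
≼⇒++ (∷≼ p≼w) with ≼⇒++ p≼w
... | q , refl = q , refl

≼-∷ʳ-exclusive : ∀ p {w} → (p ++ [ false ]) ≼ w → ¬ ((p ++ [ true ]) ≼ w)
≼-∷ʳ-exclusive [] (∷≼ _) ()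
≼-∷ʳ-exclusive (b ∷ p) (∷≼ ≼w) (∷≼ ≼w') = ≼-∷ʳ-exclusive p ≼w ≼w'

_≼?_ : (p w : Addr) → Dec (p ≼ w)
[] ≼? w = yes []≼
(b ∷ p) ≼? [] = no λ ()
(b ∷ p) ≼? (c ∷ w) with b ≟B c | p ≼? w
... | yes refl | yes p≼w = yes (∷≼ p≼w)
... | yes refl | no p⋠w = no λ { (∷≼ p≼w) → p⋠w p≼w }
... | no b≢c | _ = no λ { (∷≼ _) → b≢c refl }

_∈Addrs?_ : (w : Addr) (V : List Addr) → Dec (w ∈ V)
_∈Addrs?_ = DecMembership._∈?_ (List.≡-dec _≟B_)

¬⊆⇒witness : ∀ X Y p → ¬ (∀ w → InSubtree X p w → InSubtree Y p w) → ∃ λ w → w ∈ X × p ≼ w × w ∉ Y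
¬⊆⇒witness X Y p X⊈Y with any? (λ w → (p ≼? w) ×-dec ¬? (w ∈Addrs? Y)) X
... | yes found = find found
... | no none = ⊥-elim (X⊈Y X⊆Y)
  where
  X⊆Y : ∀ w → InSubtree X p w → InSubtree Y p w
  X⊆Y w (w∈X , p≼w) with w ∈Addrs? Y
  ... | yes w∈Y = w∈Y , p≼w
  ... | no w∉Y = ⊥-elim (none (lose w∈X (p≼w , w∉Y)))

child : Bool → Tree → Tree → Tree
child false l r = l
child true l r = r

lvs-node⁻ : ∀ {v l r w} → w ∈ lvs (node v l r) → ∃ λ b → ∃ λ w′ → w ≡ b ∷ w′ × w′ ∈ lvs (child b l r)
lvs-node⁻ {v} {l} {r} w∈ with ∈-++⁻ (map (false ∷_) (lvs l)) w∈
... | inj₁ w∈ˡ = let w′ , w′∈ , eq = ∈-map⁻ (false ∷_) w∈ˡ in false , w′ , eq , w′∈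
... | inj₂ w∈ʳ = let w′ , w′∈ , eq = ∈-map⁻ (true ∷_) w∈ʳ in true , w′ , eq , w′∈

subtree-++ : ∀ T p {t} q → subtree T p ≡ just t → subtree T (p ++ q) ≡ subtree t q
subtree-++ T [] q refl = refl
subtree-++ (node v l r) (false ∷ p) q eq = subtree-++ l p q eq
subtree-++ (node v l r) (true ∷ p) q eq = subtree-++ r p q eq

subtree-child : ∀ T p {v l r} → subtree T p ≡ just (node v l r) → ∀ b → subtree T (p ++ [ b ]) ≡ just (child b l r)
subtree-child T p eq false = subtree-++ T p [ false ] eq
subtree-child T p eq true = subtree-++ T p [ true ] eq

subtree-leaf⇒∈lvs : ∀ T p → subtree T p ≡ just leaf → p ∈ lvs T
subtree-leaf⇒∈lvs leaf [] refl = here refl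
subtree-leaf⇒∈lvs (node v l r) (false ∷ p) eq = ∈-++⁺ˡ (∈-map⁺ (false ∷_) (subtree-leaf⇒∈lvs l p eq))
subtree-leaf⇒∈lvs (node v l r) (true ∷ p) eq =
  ∈-++⁺ʳ (map (false ∷_) (lvs l)) (∈-map⁺ (true ∷_) (subtree-leaf⇒∈lvs r p eq))

subtree-labels : ∀ T p {t} → subtree T p ≡ just t → labels t ⊆ labels T
subtree-labels T [] refl = λ x∈ → x∈
subtree-labels (node v l r) (false ∷ p) eq = there ∘ ∈-++⁺ˡ ∘ subtree-labels l p eq
subtree-labels (node v l r) (true ∷ p) eq = there ∘ ∈-++⁺ʳ (labels l) ∘ subtree-labels r p eq

labels-child : ∀ b {l r} → labels (child b l r) ⊆ labels l ++ labels r
labels-child false = ∈-++⁺ˡ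
labels-child true {l} = ∈-++⁺ʳ (labels l)

Unique-labels-node⁻ : ∀ {v l r} → Unique (labels (node v l r)) →
  v ∉ labels l ++ labels r × Unique (labels l) × Unique (labels r) × Disjoint (labels l) (labels r)
Unique-labels-node⁻ {l = l} (v∉ ∷ lr!) = (λ v∈ → lookup v∉ v∈ refl) , Unique-++⁻ (labels l) lr!

Unique-labels-subtree : ∀ T p {t} → subtree T p ≡ just t → Unique (labels T) → Unique (labels t)
Unique-labels-subtree T [] refl T! = T!
Unique-labels-subtree (node v l r) (false ∷ p) eq T! =
  Unique-labels-subtree l p eq (proj₁ (proj₂ (Unique-labels-node⁻ T!)))
Unique-labels-subtree (node v l r) (true ∷ p) eq T! =
  Unique-labels-subtree r p eq (proj₁ (proj₂ (proj₂ (Unique-labels-node⁻ T!))))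

pathClause-node : ∀ v l r b w → pathClause (node v l r) (b ∷ w) ≡ (v , not b) ∷ pathClause (child b l r) w
pathClause-node v l r false w = refl
pathClause-node v l r true w = refl

pathClause-++ : ∀ T p {t} q → subtree T p ≡ just t → pathClause T (p ++ q) ≡ pathClause T p ++ pathClause t q
pathClause-++ leaf [] q refl = refl
pathClause-++ (node v l r) [] q refl = refl
pathClause-++ (node v l r) (false ∷ p) q eq = cong ((v , true) ∷_) (pathClause-++ l p q eq)
pathClause-++ (node v l r) (true ∷ p) q eq = cong ((v , false) ∷_) (pathClause-++ r p q eq)

pathClause⊆labels : ∀ T w {ℓ} → ℓ ∈ pathClause T w → proj₁ ℓ ∈ labels T
pathClause⊆labels leaf w ()
pathClause⊆labels (node v l r) [] ()
pathClause⊆labels (node v l r) (b ∷ w) ℓ∈ rewrite pathClause-node v l r b w with ℓ∈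
... | here refl = here refl
... | there ℓ∈′ = there (labels-child b {l} {r} (pathClause⊆labels (child b l r) w ℓ∈′))

pathClause-IsClause : ∀ T w → Unique (labels T) → IsClause (pathClause T w)
pathClause-IsClause leaf w _ ()
pathClause-IsClause (node v l r) [] _ ()
pathClause-IsClause (node v l r) (b ∷ w) T! rewrite pathClause-node v l r b w = clause
  where
  v∉ : v ∉ labels l ++ labels r
  v∉ = proj₁ (Unique-labels-node⁻ {v} {l} {r} T!)
  P : Clause
  P = pathClause (child b l r) w
  v∉P : ∀ {ℓ} → ℓ ∈ P → proj₁ ℓ ≢ v
  v∉P ℓ∈ refl = v∉ (labels-child b {l} {r} (pathClause⊆labels (child b l r) w ℓ∈))
  P-clause : IsClause P
  P-clause = pathClause-IsClause (child b l r) w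
    (Unique-labels-subtree (node v l r) [ b ] (subtree-child (node v l r) [] refl b) T!)
  clause : IsClause ((v , not b) ∷ P)
  clause (here refl) (here ℓ̄≡) = compl-≢ _ ℓ̄≡
  clause (here refl) (there ℓ̄∈) = v∉P ℓ̄∈ refl
  clause (there ℓ∈) (here ℓ̄≡) = v∉P ℓ∈ (cong proj₁ ℓ̄≡)
  clause (there ℓ∈) (there ℓ̄∈) = P-clause ℓ∈ ℓ̄∈

lvs-diverge : ∀ T {w w′} → w ∈ lvs T → w′ ∈ lvs T →
  w ≡ w′ ⊎ ∃ λ ℓ → ℓ ∈ pathClause T w′ × compl ℓ ∈ pathClause T w
lvs-diverge leaf (here refl) (here refl) = inj₁ refl
lvs-diverge (node v l r) w∈ w′∈ with lvs-node⁻ {v} {l} {r} w∈ | lvs-node⁻ {v} {l} {r} w′∈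
... | false , a , refl , a∈ | true , a′ , refl , a′∈ = inj₂ ((v , false) , here refl , here refl)
... | true , a , refl , a∈ | false , a′ , refl , a′∈ = inj₂ ((v , true) , here refl , here refl)
... | false , a , refl , a∈ | false , a′ , refl , a′∈ with lvs-diverge l a∈ a′∈
...   | inj₁ refl = inj₁ refl
...   | inj₂ (ℓ , ℓ∈ , ℓ̄∈) = inj₂ (ℓ , there ℓ∈ , there ℓ̄∈)
lvs-diverge (node v l r) w∈ w′∈ | true , a , refl , a∈ | true , a′ , refl , a′∈ with lvs-diverge r a∈ a′∈
...   | inj₁ refl = inj₁ refl
...   | inj₂ (ℓ , ℓ∈ , ℓ̄∈) = inj₂ (ℓ , there ℓ∈ , there ℓ̄∈)

∉-pathClause-root : ∀ t {ℓ} → ℓ ∉ pathClause t []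
∉-pathClause-root leaf ()
∉-pathClause-root (node _ _ _) ()

edge-on-path : ∀ T p {v l r} b {w} → subtree T p ≡ just (node v l r) → (p ++ [ b ]) ≼ w →
               (v , not b) ∈ pathClause T w
edge-on-path T p {v} {l} {r} b eq pb≼w with ≼⇒++ pb≼w
... | q , refl = subst ((v , not b) ∈_) (sym path≡) (∈-++⁺ʳ (pathClause T p) (here refl))
  where
  open ≡-Reasoning
  path≡ : pathClause T ((p ++ [ b ]) ++ q) ≡ pathClause T p ++ (v , not b) ∷ pathClause (child b l r) q
  path≡ = begin
    pathClause T ((p ++ [ b ]) ++ q)                  ≡⟨ cong (pathClause T) (List.++-assoc p [ b ] q) ⟩
    pathClause T (p ++ b ∷ q)                         ≡⟨ pathClause-++ T p (b ∷ q) eq ⟩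
    pathClause T p ++ pathClause (node v l r) (b ∷ q) ≡⟨ cong (pathClause T p ++_) (pathClause-node v l r b q) ⟩
    pathClause T p ++ (v , not b) ∷ pathClause (child b l r) q ∎

pathClause-child⁻ : ∀ T p {v l r} b {ℓ} → subtree T p ≡ just (node v l r) → ℓ ∈ pathClause T (p ++ [ b ]) →
                    ℓ ∈ pathClause T p ⊎ ℓ ≡ (v , not b)
pathClause-child⁻ T p {v} {l} {r} b eq ℓ∈
  rewrite pathClause-++ T p [ b ] eq | pathClause-node v l r b []
  with ∈-++⁻ (pathClause T p) ℓ∈
... | inj₁ ℓ∈p = inj₁ ℓ∈p
... | inj₂ (here ℓ≡) = inj₂ ℓ≡
... | inj₂ (there ℓ∈root) = ⊥-elim (∉-pathClause-root (child b l r) ℓ∈root)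

implicate-meets-leaf : ∀ T u → Unique (labels T) → (∀ {w} → w ∈ lvs T → u w ∉ labels T) →
  ∀ {C} → IsClause C → DF1 T u ⊨ C → ∀ {w} → w ∈ lvs T →
  (u w , true) ∈ C ⊎ ∃ λ ℓ → ℓ ∈ pathClause T w × compl ℓ ∈ C
implicate-meets-leaf T u T! u-fresh {C} C-clause C-implied {w} w∈
  with (u w , true) ∈? C | any? (λ ℓ → compl ℓ ∈? C) (pathClause T w)
... | yes uw∈ | _ = inj₁ uw∈
... | no _ | yes hit = inj₂ (find hit)
... | no uw∉ | no miss =
  -- then C ∪ C_w ∪ {¬u_w} is a clause, and falsifying it satisfies D(F₁(T)) but not C
  let _ , x∈C , x-sat = C-implied α α-satisfies in ⊥-elim (falsify-falsifies D-clause (∈-++⁺ˡ x∈C) x-sat)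
  where
  D : Clause
  D = C ++ pathClause T w ++ [ (u w , false) ]
  path-vs-u : ∀ {x} → x ∈ pathClause T w → compl x ∉ [ (u w , false) ]
  path-vs-u x∈ (here x̄≡) = u-fresh w∈ (subst (_∈ labels T) (cong proj₁ x̄≡) (pathClause⊆labels T w x∈))
  C-vs-rest : ∀ {x} → x ∈ C → compl x ∉ pathClause T w ++ [ (u w , false) ]
  C-vs-rest {x} x∈ x̄∈ with ∈-++⁻ (pathClause T w) x̄∈
  ... | inj₁ x̄∈path = miss (lose x̄∈path (subst (_∈ C) (sym (compl-involutive x)) x∈))
  ... | inj₂ (here x̄≡) = uw∉ (subst (_∈ C) (trans (sym (compl-involutive x)) (cong compl x̄≡)) x∈)
  D-clause : IsClause D
  D-clause = IsClause-++⁺ C-clause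
    (IsClause-++⁺ (pathClause-IsClause T w T!) (λ { (here refl) (here ()) }) path-vs-u) C-vs-rest
  α : Assignment
  α = falsify D
  α-satisfies : satF α (DF1 T u)
  α-satisfies D′∈ with ∈-map⁻ (dopedClause T u) D′∈
  ... | w′ , w′∈ , refl with lvs-diverge T w∈ w′∈
  ...   | inj₁ refl = (u w , true) , ∈-++⁺ʳ (pathClause T w) (here refl) ,
          satL-compl α _ (falsify-falsifies D-clause (∈-++⁺ʳ C (∈-++⁺ʳ (pathClause T w) (here refl))))
  ...   | inj₂ (ℓ , ℓ∈ , ℓ̄∈) = ℓ , ∈-++⁺ˡ ℓ∈ ,
          satL-compl α ℓ (falsify-falsifies D-clause (∈-++⁺ʳ C (∈-++⁺ˡ ℓ̄∈)))

dopedLiterals : Tree → (Addr → Var) → List Addr → Clause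
dopedLiterals T u V = concat (map (dopedClause T u) V)

pathClause⊆dopedLiterals : ∀ T u {V w} → w ∈ V → pathClause T w ⊆ dopedLiterals T u V
pathClause⊆dopedLiterals T u w∈ ℓ∈ = ∈-concat⁺′ (∈-++⁺ˡ ℓ∈) (∈-map⁺ (dopedClause T u) w∈)

∈CV⁻ : ∀ T u V {x} → x ∈ CV T u V → x ∈ dopedLiterals T u V × compl x ∉ dopedLiterals T u V
∈CV⁻ T u V = ∈-filter⁻ (λ y → ¬? (compl y ∈? dopedLiterals T u V)) {xs = dopedLiterals T u V}

compl∈dopedLiterals⇒∉CV : ∀ T u V {x} → compl x ∈ dopedLiterals T u V → x ∉ CV T u V
compl∈dopedLiterals⇒∉CV T u V x̄∈ x∈ = proj₂ (∈CV⁻ T u V x∈) x̄∈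

doping∉CV : ∀ T u → ValidDoping T u → ∀ V → V ⊆A lvs T → ∀ {w} → w ∈ lvs T → w ∉ V → (u w , true) ∉ CV T u V
doping∉CV T u (u-injective , u-fresh) V V⊆lvs w∈ w∉ uw∈
  with ∈-concat⁻′ (map (dopedClause T u) V) (proj₁ (∈CV⁻ T u V uw∈))
... | D , uw∈D , D∈ with ∈-map⁻ (dopedClause T u) D∈
...   | w′ , w′∈V , refl with ∈-++⁻ (pathClause T w′) uw∈D
...     | inj₁ uw∈path = u-fresh w∈ (pathClause⊆labels T w′ uw∈path)
...     | inj₂ (here uw≡) = w∉ (subst (_∈ V) (sym (u-injective w∈ (V⊆lvs w′∈V) (cong proj₁ uw≡))) w′∈V)

module ExcessCount
  (k : ℕ) (T : Tree) (T! : Unique (labels T)) (u : Addr → Var) (u-valid : ValidDoping T u)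
  (V : Bool → List Addr) (V⊆lvs : ∀ s → V s ⊆A lvs T)
  (deep : ∀ {w} → w ∈ lvs T → suc k ≤ length w)
  (separated : ∀ s p {t} → subtree T p ≡ just t → length p ≡ k → ∃ λ w → w ∈ V s × p ≼ w × w ∉ V (not s))
  (C : Clause) (C-clause : IsClause C) (C-implied : DF1 T u ⊨ C)
  where

  u-injective : ∀ {w w′} → w ∈ lvs T → w′ ∈ lvs T → u w ≡ u w′ → w ≡ w′
  u-injective = proj₁ u-valid

  u-fresh : ∀ {w} → w ∈ lvs T → u w ∉ labels T
  u-fresh = proj₂ u-valid

  Excess : Bool → Lit → Set
  Excess s x = x ∈ C ∖C CV T u (V s)

  excess : ∀ {s x} → x ∈ C → x ∉ CV T u (V s) → Excess s x
  excess {s} = ∈-filter⁺ (λ y → ¬? (y ∈? CV T u (V s)))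

  VarBelow : Addr → Tree → Var → Set
  VarBelow p t x = x ∈ labels t ⊎ ∃ λ w → w ∈ lvs T × p ≼ w × x ≡ u w

  VarBelow-child : ∀ p {v l r} b {x} → VarBelow (p ++ [ b ]) (child b l r) x → VarBelow p (node v l r) x
  VarBelow-child p b (inj₁ x∈) = inj₁ (there (labels-child b x∈))
  VarBelow-child p b (inj₂ (w , w∈ , pb≼w , x≡)) = inj₂ (w , w∈ , ≼-trans (≼-++ p [ b ]) pb≼w , x≡)

  label-not-below-child : ∀ p {v l r} b → subtree T p ≡ just (node v l r) → ¬ VarBelow (p ++ [ b ]) (child b l r) v
  label-not-below-child p {v} {l} {r} b eq (inj₁ v∈) =
    proj₁ (Unique-labels-node⁻ {v} {l} {r} (Unique-labels-subtree T p eq T!)) (labels-child b v∈)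
  label-not-below-child p b eq (inj₂ (w , w∈ , _ , v≡)) =
    u-fresh w∈ (subst (_∈ labels T) v≡ (subtree-labels T p eq (here refl)))

  siblings-disjoint : ∀ p {v l r x} → subtree T p ≡ just (node v l r) →
                      ¬ (VarBelow (p ++ [ false ]) l x × VarBelow (p ++ [ true ]) r x)
  siblings-disjoint p {v} {l} {r} eq (inj₁ x∈l , inj₁ x∈r) =
    proj₂ (proj₂ (proj₂ (Unique-labels-node⁻ {v} {l} {r} (Unique-labels-subtree T p eq T!)))) (x∈l , x∈r)
  siblings-disjoint p eq (inj₁ x∈l , inj₂ (w , w∈ , _ , x≡)) =
    u-fresh w∈ (subst (_∈ labels T) x≡ (subtree-labels T p eq (there (∈-++⁺ˡ x∈l))))
  siblings-disjoint p {l = l} eq (inj₂ (w , w∈ , _ , x≡) , inj₁ x∈r) =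
    u-fresh w∈ (subst (_∈ labels T) x≡ (subtree-labels T p eq (there (∈-++⁺ʳ (labels l) x∈r))))
  siblings-disjoint p eq (inj₂ (w , w∈ , p0≼w , x≡) , inj₂ (w′ , w′∈ , p1≼w′ , x≡′))
    with u-injective w∈ w′∈ (trans (sym x≡) x≡′)
  ... | refl = ≼-∷ʳ-exclusive p p0≼w p1≼w′

  leaf-too-shallow : ∀ p {n} → subtree T p ≡ just leaf → length p + suc n ≡ k → ⊥
  leaf-too-shallow p eq len =
    <-asym (deep (subtree-leaf⇒∈lvs T p eq)) (subst (length p <_) len (m<m+n (length p) z<s))

  depth-step : ∀ (p : Addr) b {n} → length p + suc n ≡ k → length (p ++ [ b ]) + n ≡ k
  depth-step p b {n} len = trans (cong (_+ n) (List.length-++ p {[ b ]})) (trans (+-assoc (length p) 1 n) len)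

  leaf-below : ∀ s n p {t} → subtree T p ≡ just t → length p + n ≡ k → ∃ λ w → w ∈ V s × p ≼ w
  leaf-below s zero p eq len =
    let w , w∈ , p≼w , _ = separated s p eq (trans (sym (+-identityʳ _)) len) in w , w∈ , p≼w
  leaf-below s (suc n) p {leaf} eq len = ⊥-elim (leaf-too-shallow p eq len)
  leaf-below s (suc n) p {node v l r} eq len =
    let w , w∈ , p0≼w = leaf-below s n (p ++ [ false ]) (subtree-child T p eq false) (depth-step p false len)
    in w , w∈ , ≼-trans (≼-++ p [ false ]) p0≼w

  Counted : Addr → Tree → Bool × Lit → Set
  Counted p t (s , x) = Excess s x × VarBelow p t (proj₁ x)

  Counted-child : ∀ p {v l r} b {i} → Counted (p ++ [ b ]) (child b l r) i → Counted p (node v l r) i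
  Counted-child p b (x-excess , x-below) = x-excess , VarBelow-child p b x-below

  Avoids : Addr → Set
  Avoids p = ∀ {ℓ} → ℓ ∈ pathClause T p → compl ℓ ∉ C

  Avoids-child : ∀ p {v l r} b → subtree T p ≡ just (node v l r) → Avoids p → compl (v , not b) ∉ C →
                 Avoids (p ++ [ b ])
  Avoids-child p b eq avoids v̄∉C ℓ∈ with pathClause-child⁻ T p b eq ℓ∈
  ... | inj₁ ℓ∈p = avoids ℓ∈p
  ... | inj₂ refl = v̄∉C

  record Tally (p : Addr) (t : Tree) (n : ℕ) : Set where
    field
      items : List (Bool × Lit)
      items-unique : Unique items
      items-counted : ∀ {i} → i ∈ items → Counted p t i
      items-many : suc n * 2 ≤ length items   -- not 2 * suc n: suc (suc n) * 2 unfolds to 2 + suc n * 2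

  -- An item obtained from a leaf of Vₛ is tagged s exactly when its variable is a tree label;
  -- this keeps the two items found at a node of depth k apart.
  Sided : Bool → Bool × Lit → Set
  Sided s (s′ , x) = s′ ≡ s × proj₁ x ∈ labels T ⊎ s′ ≡ not s × proj₁ x ∉ labels T

  sided-distinct : ∀ {i j} → Sided false i → Sided true j → i ≢ j
  sided-distinct (inj₁ (refl , _)) (inj₁ (() , _)) refl
  sided-distinct (inj₁ (_ , x∈)) (inj₂ (_ , x∉)) refl = x∉ x∈
  sided-distinct (inj₂ (_ , x∉)) (inj₁ (_ , x∈)) refl = x∉ x∈
  sided-distinct (inj₂ (refl , _)) (inj₂ (() , _)) refl

  leaf-item : ∀ s p {t} → subtree T p ≡ just t → Avoids p → ∀ {w} → w ∈ V s → p ≼ w → w ∉ V (not s) →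
              Σ (Bool × Lit) λ i → Counted p t i × Sided s i
  leaf-item s p eq avoids {w} w∈V p≼w w∉V′
    with implicate-meets-leaf T u T! u-fresh C-clause C-implied (V⊆lvs s w∈V)
  ... | inj₁ uw∈C =
    (not s , (u w , true)) ,
    (excess uw∈C (doping∉CV T u u-valid (V (not s)) (V⊆lvs (not s)) (V⊆lvs s w∈V) w∉V′) ,
     inj₂ (w , V⊆lvs s w∈V , p≼w , refl)) ,
    inj₂ (refl , u-fresh (V⊆lvs s w∈V))
  ... | inj₂ (ℓ , ℓ∈ , ℓ̄∈C) with ≼⇒++ p≼w
  ...   | q , refl with ∈-++⁻ (pathClause T p) (subst (ℓ ∈_) (pathClause-++ T p q eq) ℓ∈)
  ...     | inj₁ ℓ∈above = ⊥-elim (avoids ℓ∈above ℓ̄∈C)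
  ...     | inj₂ ℓ∈below =
    (s , compl ℓ) ,
    (excess ℓ̄∈C (compl∈dopedLiterals⇒∉CV T u (V s)
       (subst (_∈ dopedLiterals T u (V s)) (sym (compl-involutive ℓ)) (pathClause⊆dopedLiterals T u w∈V ℓ∈))) ,
     inj₁ (pathClause⊆labels _ q ℓ∈below)) ,
    inj₁ (refl , subtree-labels T p eq (pathClause⊆labels _ q ℓ∈below))

  tally-base : ∀ p {t} → subtree T p ≡ just t → length p ≡ k → Avoids p → Tally p t 0
  tally-base p eq len avoids =
    let w₀ , w₀∈ , p≼w₀ , w₀∉ = separated false p eq len
        w₁ , w₁∈ , p≼w₁ , w₁∉ = separated true p eq len
        i₀ , i₀-counted , i₀-sided = leaf-item false p eq avoids w₀∈ p≼w₀ w₀∉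
        i₁ , i₁-counted , i₁-sided = leaf-item true p eq avoids w₁∈ p≼w₁ w₁∉
    in record
      { items = i₀ ∷ i₁ ∷ []
      ; items-unique = (sided-distinct i₀-sided i₁-sided ∷ []) ∷ [] ∷ []
      ; items-counted = λ { (here refl) → i₀-counted ; (there (here refl)) → i₁-counted }
      ; items-many = ≤-refl
      }

  tally-one-child : ∀ n p {v l r} d → subtree T p ≡ just (node v l r) → length p + suc n ≡ k →
                    (v , not d) ∈ C → Tally (p ++ [ d ]) (child d l r) n → Tally p (node v l r) (suc n)
  tally-one-child n p {v} {l} {r} d eq len v∈C below = record
    { items = (false , (v , not d)) ∷ (true , (v , not d)) ∷ items
    ; items-unique = ((λ ()) ∷ fresh false) ∷ fresh true ∷ items-unique
    ; items-counted = λ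
        { (here refl) → counted false
        ; (there (here refl)) → counted true
        ; (there (there i∈)) → Counted-child p d (items-counted i∈) }
    ; items-many = s≤s (s≤s items-many)
    }
    where
    open Tally below
    fresh : ∀ s → All ((s , (v , not d)) ≢_) items
    fresh s = All.tabulate λ { i∈ refl → label-not-below-child p d eq (proj₂ (items-counted i∈)) }
    counted : ∀ s → Counted p (node v l r) (s , (v , not d))
    counted s =
      let w , w∈ , ≼w = leaf-below s n (p ++ [ not d ]) (subtree-child T p eq (not d)) (depth-step p (not d) len)
      in excess v∈C (compl∈dopedLiterals⇒∉CV T u (V s)
                      (pathClause⊆dopedLiterals T u w∈ (edge-on-path T p (not d) eq ≼w))) ,
         inj₁ (here refl)

  tally-both-children : ∀ n p {v l r} → subtree T p ≡ just (node v l r) →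
                        Tally (p ++ [ false ]) l n → Tally (p ++ [ true ]) r n → Tally p (node v l r) (suc n)
  tally-both-children n p eq left right = record
    { items = L.items ++ R.items
    ; items-unique = Unique.++⁺ L.items-unique R.items-unique λ { (i∈L , i∈R) →
        siblings-disjoint p eq (proj₂ (L.items-counted i∈L) , proj₂ (R.items-counted i∈R)) }
    ; items-counted = λ i∈ →
        [ Counted-child p false ∘ L.items-counted , Counted-child p true ∘ R.items-counted ]′ (∈-++⁻ L.items i∈)
    ; items-many = subst (_ ≤_) (sym (List.length-++ L.items)) (*2-step n L.items-many R.items-many)
    }
    where
    module L = Tally left
    module R = Tally right

  tally : ∀ n p {t} → subtree T p ≡ just t → length p + n ≡ k → Avoids p → Tally p t n
  tally zero p eq len avoids = tally-base p eq (trans (sym (+-identityʳ _)) len) avoids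
  tally (suc n) p {leaf} eq len _ = ⊥-elim (leaf-too-shallow p eq len)
  tally (suc n) p {node v l r} eq len avoids = by-cases ((v , true) ∈? C) ((v , false) ∈? C)
    where
    below : ∀ d → compl (v , not d) ∉ C → Tally (p ++ [ d ]) (child d l r) n
    below d v̄∉C =
      tally n (p ++ [ d ]) (subtree-child T p eq d) (depth-step p d len) (Avoids-child p d eq avoids v̄∉C)
    by-cases : Dec ((v , true) ∈ C) → Dec ((v , false) ∈ C) → Tally p (node v l r) (suc n)
    by-cases (yes v∈C) _ = tally-one-child n p false eq len v∈C (below false (C-clause v∈C))
    by-cases (no _) (yes v̄∈C) = tally-one-child n p true eq len v̄∈C (below true (C-clause v̄∈C))
    by-cases (no v∉C) (no v̄∉C) = tally-both-children n p eq (below false v̄∉C) (below true v∉C)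

  excess-bound : suc k * 2 ≤ card (C ∖C CV T u (V false)) + card (C ∖C CV T u (V true))
  excess-bound = ≤-trans items-many (subst (length items ≤_) length-tagged
    (Unique-⊆⇒length≤ (≡-dec _≟B_ _≟L_) items-unique items⊆tagged))
    where
    open Tally (tally k [] refl refl (⊥-elim ∘ ∉-pathClause-root T))
    tag : Bool → Lit → Bool × Lit
    tag s x = s , x
    distinct-excess : Bool → Clause
    distinct-excess s = deduplicate _≟L_ (C ∖C CV T u (V s))
    tagged : List (Bool × Lit)
    tagged = map (tag false) (distinct-excess false) ++ map (tag true) (distinct-excess true)
    items⊆tagged : items ⊆ tagged
    items⊆tagged {false , x} i∈ = ∈-++⁺ˡ (∈-map⁺ (tag false) (∈-deduplicate⁺ _≟L_ (proj₁ (items-counted i∈))))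
    items⊆tagged {true , x} i∈ =
      ∈-++⁺ʳ (map (tag false) (distinct-excess false)) (∈-map⁺ (tag true) (∈-deduplicate⁺ _≟L_ (proj₁ (items-counted i∈))))
    length-tagged : length tagged ≡ card (C ∖C CV T u (V false)) + card (C ∖C CV T u (V true))
    length-tagged = trans (List.length-++ (map (tag false) (distinct-excess false)))
      (cong₂ _+_ (List.length-map (tag false) (distinct-excess false))
                 (List.length-map (tag true) (distinct-excess true)))

lemma6p12 : (k : ℕ) (T : Tree) → Unique (labels T) →
            (u : Addr → Var) → ValidDoping T u →
            (V₀ V₁ : List Addr) → NonEmpty V₀ → NonEmpty V₁ →
            V₀ ⊆A lvs T → V₁ ⊆A lvs T →
            DepthIncomparable k T V₀ V₁ →
            ∀ (C' : Clause) →
            ¬ (InHyperedge k (DF1 T u) (CV T u V₀) C' ×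
               InHyperedge k (DF1 T u) (CV T u V₁) C')
lemma6p12 k T T! u u-valid V₀ V₁ _ _ V₀⊆lvs V₁⊆lvs (deep , incomparable) C'
          ((C'-prime , _ , excess₀≤k) , (_ , _ , excess₁≤k)) =
  suc*2≰+ k (≤-trans excess-bound (+-mono-≤ excess₀≤k excess₁≤k))
  where
  V : Bool → List Addr
  V s = if s then V₁ else V₀
  V⊆lvs : ∀ s → V s ⊆A lvs T
  V⊆lvs false = V₀⊆lvs
  V⊆lvs true = V₁⊆lvs
  separated : ∀ s p {t} → subtree T p ≡ just t → length p ≡ k → ∃ λ w → w ∈ V s × p ≼ w × w ∉ V (not s)
  separated false p eq len = ¬⊆⇒witness V₀ V₁ p (proj₁ (incomparable p _ eq len))
  separated true p eq len = ¬⊆⇒witness V₁ V₀ p (proj₂ (incomparable p _ eq len))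
  open ExcessCount k T T! u u-valid V V⊆lvs deep separated C' (proj₁ C'-prime) (proj₁ (proj₂ C'-prime))
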